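{- Let $\mathbb{F}_{81}$ be the field with $81$ elements and let $G_{81,20}=\{x\in\mathbb{F}_{81}: x^{20}=1\}$ be the unique subgroup of order $20$ of $\mathbb{F}_{81}^\times$. For $a,b,c\in G_{81,20}$, we have $a+b+c=0$ if and only if $a=b=c$. -}

module Defs where

open import Data.Nat using (ℕ; zero; suc)
open import Relation.Binary.PropositionalEquality using (_≡_)

data F3 : Set where
  z0 z1 z2 : F3

_+₃_ : F3 → F3 → F3
z0 +₃ y  = y
z1 +₃ z0 = z1
z1 +₃ z1 = z2
z1 +₃ z2 = z0
z2 +₃ z0 = z2
z2 +₃ z1 = z0
z2 +₃ z2 = z1

_*₃_ : F3 → F3 → F3
z0 *₃ y  = z0
z1 *₃ y  = y
z2 *₃ z0 = z0
z2 *₃ z1 = z2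
z2 *₃ z2 = z1

infixl 6 _+₃_
infixl 7 _*₃_

-- 𝔽₈₁ = 𝔽₃[X]/(X⁴ + 2X³ + 2)  (the Conway polynomial for 3⁴, irreducible over 𝔽₃).
-- An element  f c0 c1 c2 c3  represents  c0 + c1 α + c2 α² + c3 α³,
-- where α⁴ = α³ + 1.
data F81 : Set where
  f : F3 → F3 → F3 → F3 → F81

0F : F81
0F = f z0 z0 z0 z0

1F : F81
1F = f z1 z0 z0 z0

_+F_ : F81 → F81 → F81
f a0 a1 a2 a3 +F f b0 b1 b2 b3 = f (a0 +₃ b0) (a1 +₃ b1) (a2 +₃ b2) (a3 +₃ b3)

-- Polynomial product (coefficients d0..d6) reduced using
-- α⁴ = α³ + 1,  α⁵ = α³ + α + 1,  α⁶ = α³ + α² + α + 1.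
_*F_ : F81 → F81 → F81
f a0 a1 a2 a3 *F f b0 b1 b2 b3 =
  f (d0 +₃ d4 +₃ d5 +₃ d6) (d1 +₃ d5 +₃ d6) (d2 +₃ d6) (d3 +₃ d4 +₃ d5 +₃ d6)
  where
  d0 = a0 *₃ b0
  d1 = a0 *₃ b1 +₃ a1 *₃ b0
  d2 = a0 *₃ b2 +₃ a1 *₃ b1 +₃ a2 *₃ b0
  d3 = a0 *₃ b3 +₃ a1 *₃ b2 +₃ a2 *₃ b1 +₃ a3 *₃ b0
  d4 = a1 *₃ b3 +₃ a2 *₃ b2 +₃ a3 *₃ b1
  d5 = a2 *₃ b3 +₃ a3 *₃ b2
  d6 = a3 *₃ b3

infixl 6 _+F_
infixl 7 _*F_

_^F_ : F81 → ℕ → F81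
x ^F zero  = 1F
x ^F suc n = x *F (x ^F n)

infixr 8 _^F_

InG81-20 : F81 → Set
InG81-20 x = x ^F 20 ≡ 1F

-- In characteristic 3 we have a + a + a = 0, which gives one direction.  For the
-- other, a + b + c = 0 forces c = −(a + b), so it suffices to check the 400 pairs
-- a, b ∈ G with −(a + b) ∈ G: each such pair has a = b, and then c = −2a = a.
module Submission where

open import Defs
open import Data.List using (List; []; _∷_; cartesianProduct; cartesianProductWith)
open import Data.List.Membership.Propositional using (_∈_)
open import Data.List.Membership.Propositional.Properties
  using (∈-cartesianProduct⁺; ∈-cartesianProductWith⁺)
open import Data.List.Relation.Unary.All as All using (All; all?)
open import Data.List.Relation.Unary.Any using (here; there)
open import Data.Product using (_×_; _,_)
open import Function.Bundles using (_⇔_; mk⇔)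
open import Relation.Binary.Definitions using (DecidableEquality)
open import Relation.Binary.PropositionalEquality using (_≡_; refl; sym; cong)
open import Relation.Nullary.Decidable using (yes; no; map′; _×-dec_; _→-dec_; toWitness)
open import Relation.Unary using (Decidable)

-₃_ : F3 → F3
-₃ z0 = z0
-₃ z1 = z2
-₃ z2 = z1

-F_ : F81 → F81
-F f a0 a1 a2 a3 = f (-₃ a0) (-₃ a1) (-₃ a2) (-₃ a3)

x+₃y≡0⇒y≡-₃x : ∀ x y → x +₃ y ≡ z0 → y ≡ -₃ x
x+₃y≡0⇒y≡-₃x z0 z0 refl = refl
x+₃y≡0⇒y≡-₃x z1 z2 refl = refl
x+₃y≡0⇒y≡-₃x z2 z1 refl = refl

x+Fy≡0⇒y≡-Fx : ∀ x y → x +F y ≡ 0F → y ≡ -F x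
x+Fy≡0⇒y≡-Fx (f a0 a1 a2 a3) (f b0 b1 b2 b3) eq
  with refl ← x+₃y≡0⇒y≡-₃x a0 b0 (cong (λ { (f c _ _ _) → c }) eq)
     | refl ← x+₃y≡0⇒y≡-₃x a1 b1 (cong (λ { (f _ c _ _) → c }) eq)
     | refl ← x+₃y≡0⇒y≡-₃x a2 b2 (cong (λ { (f _ _ c _) → c }) eq)
     | refl ← x+₃y≡0⇒y≡-₃x a3 b3 (cong (λ { (f _ _ _ c) → c }) eq) = refl

x+₃x+₃x≡0 : ∀ x → x +₃ x +₃ x ≡ z0
x+₃x+₃x≡0 z0 = refl
x+₃x+₃x≡0 z1 = refl
x+₃x+₃x≡0 z2 = refl

x+Fx+Fx≡0 : ∀ x → x +F x +F x ≡ 0F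
x+Fx+Fx≡0 (f a0 a1 a2 a3)
  rewrite x+₃x+₃x≡0 a0 | x+₃x+₃x≡0 a1 | x+₃x+₃x≡0 a2 | x+₃x+₃x≡0 a3 = refl

-[x+Fx]≡x : ∀ x → -F (x +F x) ≡ x
-[x+Fx]≡x x = sym (x+Fy≡0⇒y≡-Fx (x +F x) x (x+Fx+Fx≡0 x))

infix 4 _≟₃_ _≟F_

_≟₃_ : DecidableEquality F3
z0 ≟₃ z0 = yes refl
z1 ≟₃ z1 = yes refl
z2 ≟₃ z2 = yes refl
z0 ≟₃ z1 = no λ ()
z0 ≟₃ z2 = no λ ()
z1 ≟₃ z0 = no λ ()
z1 ≟₃ z2 = no λ ()
z2 ≟₃ z0 = no λ ()
z2 ≟₃ z1 = no λ ()

_≟F_ : DecidableEquality F81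
f a0 a1 a2 a3 ≟F f b0 b1 b2 b3 =
  map′ (λ { (refl , refl , refl , refl) → refl })
       (λ { refl → refl , refl , refl , refl })
       (a0 ≟₃ b0 ×-dec a1 ≟₃ b1 ×-dec a2 ≟₃ b2 ×-dec a3 ≟₃ b3)

F3-elements : List F3
F3-elements = z0 ∷ z1 ∷ z2 ∷ []

∈-F3-elements : ∀ x → x ∈ F3-elements
∈-F3-elements z0 = here refl
∈-F3-elements z1 = there (here refl)
∈-F3-elements z2 = there (there (here refl))

fromHalves : F3 × F3 → F3 × F3 → F81
fromHalves (a0 , a1) (a2 , a3) = f a0 a1 a2 a3

F81-elements : List F81
F81-elements = cartesianProductWith fromHalves F3²-elements F3²-elements
  where
  F3²-elements : List (F3 × F3)
  F3²-elements = cartesianProduct F3-elements F3-elements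

∈-F81-elements : ∀ x → x ∈ F81-elements
∈-F81-elements (f a0 a1 a2 a3) =
  ∈-cartesianProductWith⁺ fromHalves
    (∈-cartesianProduct⁺ (∈-F3-elements a0) (∈-F3-elements a1))
    (∈-cartesianProduct⁺ (∈-F3-elements a2) (∈-F3-elements a3))

open import Data.List.Membership.DecPropositional _≟F_ using (_∈?_)

inG? : Decidable InG81-20
inG? x = x ^F 20 ≟F 1F

G : List F81
G =
    f z0 z1 z1 z2 ∷ f z0 z2 z2 z1 ∷ f z1 z0 z0 z0 ∷ f z1 z0 z0 z1
  ∷ f z1 z0 z1 z1 ∷ f z1 z0 z1 z2 ∷ f z1 z1 z0 z0 ∷ f z1 z2 z0 z1
  ∷ f z1 z2 z1 z0 ∷ f z1 z2 z1 z1 ∷ f z1 z2 z2 z0 ∷ f z2 z0 z0 z0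
  ∷ f z2 z0 z0 z2 ∷ f z2 z0 z2 z1 ∷ f z2 z0 z2 z2 ∷ f z2 z1 z0 z2
  ∷ f z2 z1 z1 z0 ∷ f z2 z1 z2 z0 ∷ f z2 z1 z2 z2 ∷ f z2 z2 z0 z0
  ∷ []

-- The two exhaustive checks are abstract so that the with-abstractions in
-- theorem1 do not unfold their proofs.
abstract
  inG⇒∈G : All (λ x → InG81-20 x → x ∈ G) F81-elements
  inG⇒∈G = toWitness {a? = all? (λ x → inG? x →-dec x ∈? G) F81-elements} _

  -[a+b]∈G⇒a≡b : All (λ a → All (λ b → InG81-20 (-F (a +F b)) → a ≡ b) G) G
  -[a+b]∈G⇒a≡b =
    toWitness {a? = all? (λ a → all? (λ b → inG? (-F (a +F b)) →-dec (a ≟F b)) G) G} _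

∈-G : ∀ {x} → InG81-20 x → x ∈ G
∈-G {x} = All.lookup inG⇒∈G (∈-F81-elements x)

theorem1 : (a b c : F81) → InG81-20 a → InG81-20 b → InG81-20 c →
           ((a +F b +F c ≡ 0F) ⇔ (a ≡ b × b ≡ c))
theorem1 a b c ga gb gc = mk⇔ equal (λ { (refl , refl) → x+Fx+Fx≡0 a })
  where
  equal : a +F b +F c ≡ 0F → a ≡ b × b ≡ c
  equal sum≡0 with refl ← x+Fy≡0⇒y≡-Fx (a +F b) c sum≡0
    with refl ← All.lookup (All.lookup -[a+b]∈G⇒a≡b (∈-G ga)) (∈-G gb) gc =
    refl , sym (-[x+Fx]≡x a)
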